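{- Let $\sigma\in S_k$ be a simple involution avoiding the pattern $4321$, with $k\ge 3$. Let $\alpha_1,\dots,\alpha_k$ be nonempty permutations such that the inflation $\pi=\sigma[\alpha_1,\dots,\alpha_k]$ is an involution avoiding $4321$. Then: (i) for every fixed point $i$ of $\sigma$, $\alpha_i$ is an identity permutation $1\,2\,\cdots\,m_i$; (ii) for every $i$ with $\sigma(i)\neq i$, $\alpha_i=\alpha_{\sigma(i)}^{ -1}=\alpha_{\sigma(i)}=1\,2\,\cdots\,m_i$ for some $m_i\ge 1$. In particular all such inflations are obtained by replacing fixed points of $\sigma$ by blocks of fixed points and by replacing both entries of each transposition $(i,\sigma(i))$ of $\sigma$ by increasing blocks of the same length.
   Context: A permutation $\pi\in S_n$ avoids a pattern $s\in S_k$ if no subsequence of $\pi$ is order-isomorphic to $s$. An involution is a permutation equal to its own inverse. An interval of $\pi\in S_n$ is a set of contiguous positions $[a,b]$ whose image $\{\pi(i):a\le i\le b\}$ is a set of contiguous integers; $\pi$ is simple if its only intervals are the empty set, singletons and $[1,n]$. For $\sigma\in S_k$ and permutations $\alpha_1,\dots,\alpha_k$, the inflation $\sigma[\alpha_1,\dots,\alpha_k]$ is obtained by replacing the entry $\sigma(i)$ by a block of consecutive positions with consecutive values order-isomorphic to $\alpha_i$, the blocks being arranged relative to each other as the entries of $\sigma$. -}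

module Defs where

open import Data.Nat using (ℕ; zero; suc; _+_; _<_; _≤_; _∸_)
open import Data.Fin using (Fin; zero; suc; toℕ)
import Data.Fin as F
open import Data.Bool using (if_then_else_)
open import Data.Product using (Σ; ∃; _×_; _,_)
open import Data.Sum using (_⊎_)
open import Relation.Nullary using (¬_; does)
open import Relation.Binary.PropositionalEquality using (_≡_)
open import Function.Definitions using (Bijective)

IsPerm : ∀ {n} → (Fin n → Fin n) → Set
IsPerm f = Bijective _≡_ _≡_ f

IsInvolution : ∀ {n} → (Fin n → Fin n) → Set
IsInvolution f = ∀ x → f (f x) ≡ x

Contains : ∀ {k n} → (Fin k → Fin k) → (Fin n → Fin n) → Set
Contains {k} {n} s π =
  Σ (Fin k → Fin n) λ e →
    (∀ a b → a F.< b → e a F.< e b) ×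
    (∀ a b → (s a F.< s b → π (e a) F.< π (e b)) × (π (e a) F.< π (e b) → s a F.< s b))

Avoids : ∀ {k n} → (Fin k → Fin k) → (Fin n → Fin n) → Set
Avoids s π = ¬ Contains s π

p4321 : Fin 4 → Fin 4
p4321 zero = F.suc (F.suc (F.suc F.zero))
p4321 (suc zero) = F.suc (F.suc F.zero)
p4321 (suc (suc zero)) = F.suc F.zero
p4321 (suc (suc (suc zero))) = F.zero

-- [a,b] (a ≤ b) is an interval of π: its image is a set of contiguous
-- integers, i.e. every value lying between two values of the image is in the image.
IsInterval : ∀ {n} → (Fin n → Fin n) → Fin n → Fin n → Set
IsInterval π a b =
  ∀ x y z → a F.≤ x → x F.≤ b → a F.≤ y → y F.≤ b →
    π x F.≤ π z → π z F.≤ π y → (a F.≤ z × z F.≤ b)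

IsSimple : ∀ {n} → (Fin n → Fin n) → Set
IsSimple {n} π =
  ∀ a b → a F.≤ b → IsInterval π a b →
    a ≡ b ⊎ (toℕ a ≡ 0 × toℕ b ≡ n ∸ 1)

Σfin : ∀ {k} → (Fin k → ℕ) → ℕ
Σfin {zero} f = 0
Σfin {suc k} f = f zero + Σfin (λ i → f (suc i))

-- Start (0-based) of the block of positions of entry i in σ[α_1,…,α_k]:
-- sum of the block sizes m l for l < i.
posStart : ∀ {k} → (Fin k → ℕ) → Fin k → ℕ
posStart m i = Σfin (λ l → if does (l F.<? i) then m l else 0)

-- Start of the block of values of entry i: sum of m l over l with σ l < σ i.
valStart : ∀ {k} → (Fin k → Fin k) → (Fin k → ℕ) → Fin k → ℕ
valStart σ m i = Σfin (λ l → if does (σ l F.<? σ i) then m l else 0)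

-- π = σ[α_1,…,α_k], where α i ∈ S_(m i): position posStart i + j (j < m i)
-- is mapped to value valStart i + α i j.  (These blocks cover all of
-- Fin (Σfin m), so this determines π uniquely.)
IsInflation : ∀ {k} (σ : Fin k → Fin k) (m : Fin k → ℕ)
  (α : (i : Fin k) → Fin (m i) → Fin (m i)) → (Fin (Σfin m) → Fin (Σfin m)) → Set
IsInflation σ m α π =
  ∀ i (j : Fin (m i)) (p : Fin (Σfin m)) →
    toℕ p ≡ posStart m i + toℕ j → toℕ (π p) ≡ valStart σ m i + toℕ (α i j)

-- Let P and W be the block boundaries of π = σ[α] in positions and in values.  As π is an
-- involution it also maps value block e into position block σ e, a segment; hence the position
-- blocks met by a value block form an interval of σ.  By simplicity a value block therefore lies in
-- one position block or runs from the first to the last, and the latter would make σ send its first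
-- entry to its last, which simplicity forbids.  Comparing boundaries from left to right gives P = W,
-- i.e. m (σ i) = m i, and π maps position block i onto position block σ i.  An inversion inside a
-- block i, together with block σ i (or, if σ i = i, with two blocks straddling i, which exist by
-- simplicity), would form a 4321; so every α i is increasing and hence the identity.

module Submission where

open import Defs
open import Data.Nat using (ℕ; zero; suc; pred; _+_; _∸_; _⊔_; _<_; _≤_; z≤n; s≤s)
import Data.Nat as ℕ
open import Data.Nat.Properties
open import Algebra.Properties.CommutativeSemigroup +-commutativeSemigroup using (interchange)
open import Data.Fin using (Fin; zero; suc; toℕ; fromℕ<)
import Data.Fin as F
import Data.Fin.Properties as FP
open import Data.Bool using (if_then_else_)
open import Data.Product using (Σ; ∃-syntax; _×_; _,_; proj₁; proj₂)
open import Data.Sum using (_⊎_; inj₁; inj₂)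
open import Data.Empty using (⊥-elim)
open import Data.Unit using (tt)
open import Function using (_∘_; id; flip)
open import Relation.Nullary using (¬_; does; yes; no)
open import Relation.Nullary.Decidable using (dec-true; dec-false; toWitness; _×-dec_; _→-dec_)
open import Relation.Binary using (Rel; Transitive; tri<; tri≈; tri>)
open import Relation.Binary.PropositionalEquality

Σfin-cong : ∀ {k} {f g : Fin k → ℕ} → (∀ i → f i ≡ g i) → Σfin f ≡ Σfin g
Σfin-cong {zero}  _   = refl
Σfin-cong {suc k} f≗g = cong₂ _+_ (f≗g zero) (Σfin-cong (f≗g ∘ suc))

Σfin-+ : ∀ {k} (f g : Fin k → ℕ) → Σfin (λ i → f i + g i) ≡ Σfin f + Σfin g
Σfin-+ {zero}  f g = refl
Σfin-+ {suc k} f g =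
  trans (cong (f zero + g zero +_) (Σfin-+ (f ∘ suc) (g ∘ suc)))
        (interchange (f zero) (g zero) (Σfin (f ∘ suc)) (Σfin (g ∘ suc)))

Σfin-zero : ∀ {k} (f : Fin k → ℕ) → (∀ i → f i ≡ 0) → Σfin f ≡ 0
Σfin-zero {zero}  f f≗0 = refl
Σfin-zero {suc k} f f≗0 = cong₂ _+_ (f≗0 zero) (Σfin-zero (f ∘ suc) (f≗0 ∘ suc))

Σfin-single : ∀ {k} (f : Fin k → ℕ) (c : Fin k) → (∀ i → i ≢ c → f i ≡ 0) → Σfin f ≡ f c
Σfin-single f zero f≗0 =
  trans (cong (f zero +_) (Σfin-zero (f ∘ suc) (λ i → f≗0 (suc i) λ ()))) (+-identityʳ (f zero))
Σfin-single f (suc c) f≗0 =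
  cong₂ _+_ (f≗0 zero λ ()) (Σfin-single (f ∘ suc) c (λ i i≢c → f≗0 (suc i) (i≢c ∘ FP.suc-injective)))

-- posStart m i and valStart σ m i are, definitionally, rankStart id m (toℕ i) and
-- rankStart σ m (toℕ (σ i)).
rankStart : ∀ {k} → (Fin k → Fin k) → (Fin k → ℕ) → ℕ → ℕ
rankStart h m t = Σfin (λ l → if does (toℕ (h l) ℕ.<? t) then m l else 0)

rankStart-zero : ∀ {k} (h : Fin k → Fin k) m → rankStart h m 0 ≡ 0
rankStart-zero h m = Σfin-zero (λ l → if does (toℕ (h l) ℕ.<? 0) then m l else 0) (λ _ → refl)

rankStart-total : ∀ {k} (h : Fin k → Fin k) m → rankStart h m k ≡ Σfin m
rankStart-total h m =
  Σfin-cong (λ l → cong (λ b → if b then m l else 0) (dec-true (_ ℕ.<? _) (FP.toℕ<n (h l))))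

indicator-<-suc : ∀ x t v → (if does (x ℕ.<? suc t) then v else 0)
                          ≡ (if does (x ℕ.<? t) then v else 0) + (if does (x ℕ.≟ t) then v else 0)
indicator-<-suc x t v with <-cmp x t
... | tri< x<t _ _
  rewrite dec-true (x ℕ.<? suc t) (m<n⇒m<1+n x<t) | dec-true (x ℕ.<? t) x<t
        | dec-false (x ℕ.≟ t) (<⇒≢ x<t) = sym (+-identityʳ v)
... | tri≈ _ refl _
  rewrite dec-true (x ℕ.<? suc x) (n<1+n x) | dec-false (x ℕ.<? x) (n≮n x)
        | dec-true (x ℕ.≟ x) refl = refl
... | tri> _ _ t<x
  rewrite dec-false (x ℕ.<? suc t) (<⇒≱ (s≤s t<x)) | dec-false (x ℕ.<? t) (<⇒≯ t<x)
        | dec-false (x ℕ.≟ t) (>⇒≢ t<x) = refl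

rankStart-suc : ∀ {k} (h : Fin k → Fin k) m → (∀ {x y} → h x ≡ h y → x ≡ y) →
                ∀ c → rankStart h m (suc (toℕ (h c))) ≡ rankStart h m (toℕ (h c)) + m c
rankStart-suc h m h-injective c = begin
  rankStart h m (suc t)                ≡⟨ Σfin-cong (λ l → indicator-<-suc (toℕ (h l)) t (m l)) ⟩
  Σfin (λ l → below l + at l)          ≡⟨ Σfin-+ below at ⟩
  rankStart h m t + Σfin at            ≡⟨ cong (rankStart h m t +_) (Σfin-single at c only-c) ⟩
  rankStart h m t + at c               ≡⟨ cong (λ b → rankStart h m t + (if b then m c else 0))
                                               (dec-true (t ℕ.≟ t) refl) ⟩
  rankStart h m t + m c                ∎
  where
  open ≡-Reasoning
  t = toℕ (h c)
  below at : Fin _ → ℕ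
  below l = if does (toℕ (h l) ℕ.<? t) then m l else 0
  at    l = if does (toℕ (h l) ℕ.≟ t) then m l else 0
  only-c : ∀ l → l ≢ c → at l ≡ 0
  only-c l l≢c = cong (λ b → if b then m l else 0)
                      (dec-false (_ ℕ.≟ t) (l≢c ∘ h-injective ∘ FP.toℕ-injective))

trans-chain : ∀ {a ℓ} {A : Set a} {_R_ : Rel A ℓ} → Transitive _R_ → ∀ {n} (f : ℕ → A) →
              (∀ t → t < n → f t R f (suc t)) → ∀ {i j} → i < j → j ≤ n → f i R f j
trans-chain {_R_ = _R_} R-trans f step {i} {suc j} i<1+j 1+j≤n with m≤n⇒m<n∨m≡n (≤-pred i<1+j)
... | inj₁ i<j  =
  R-trans (trans-chain {_R_ = _R_} R-trans f step i<j (≤-trans (n≤1+n j) 1+j≤n)) (step j 1+j≤n)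
... | inj₂ refl = step i 1+j≤n

record InBlock {k} (s : ℕ → ℕ) (x : ℕ) (b : Fin k) : Set where
  constructor inBlock
  field
    from-start : s (toℕ b) ≤ x
    before-end : x < s (suc (toℕ b))

open InBlock

module Partition {k} (s : ℕ → ℕ) (size : Fin k → ℕ) (s-zero : s 0 ≡ 0)
  (s-step : ∀ b → s (suc (toℕ b)) ≡ s (toℕ b) + size b) (size-pos : ∀ b → 1 ≤ size b) where

  s-<-suc : ∀ t → t < k → s t < s (suc t)
  s-<-suc t t<k = subst (λ u → s u < s (suc u)) (FP.toℕ-fromℕ< t<k)
    (subst (s (toℕ b) <_) (sym (s-step b)) (m<m+n (s (toℕ b)) (size-pos b)))
    where b = fromℕ< t<k

  s-strictMono : ∀ {i j} → i < j → j ≤ k → s i < s j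
  s-strictMono = trans-chain {_R_ = _<_} <-trans s s-<-suc

  s-mono : ∀ {i j} → i ≤ j → j ≤ k → s i ≤ s j
  s-mono i≤j j≤k with m≤n⇒m<n∨m≡n i≤j
  ... | inj₁ i<j  = <⇒≤ (s-strictMono i<j j≤k)
  ... | inj₂ refl = ≤-refl

  size≤s : ∀ b {t} → toℕ b < t → t ≤ k → size b ≤ s t
  size≤s b b<t t≤k = ≤-trans (m≤n+m (size b) (s (toℕ b))) (subst (_≤ s _) (s-step b) (s-mono b<t t≤k))

  offset∈ : ∀ b (j : Fin (size b)) → InBlock s (s (toℕ b) + toℕ j) b
  offset∈ b j = inBlock (m≤m+n _ _)
    (subst (s (toℕ b) + toℕ j <_) (sym (s-step b)) (+-monoʳ-< (s (toℕ b)) (FP.toℕ<n j)))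

  block-offset : ∀ {x} {b : Fin k} → InBlock s x b → ∃[ j ] x ≡ s (toℕ b) + toℕ {size b} j
  block-offset {x} {b} (inBlock b≤x x<) =
    fromℕ< j<size , trans (sym (m+[n∸m]≡n b≤x)) (cong (s (toℕ b) +_) (sym (FP.toℕ-fromℕ< j<size)))
    where
    j<size : x ∸ s (toℕ b) < size b
    j<size = subst (x ∸ s (toℕ b) <_) (m+n∸m≡n (s (toℕ b)) (size b))
                   (∸-monoˡ-< (subst (x <_) (s-step b) x<) b≤x)

  start∈ : ∀ b → InBlock s (s (toℕ b)) b
  start∈ b = inBlock ≤-refl (s-<-suc (toℕ b) (FP.toℕ<n b))

  last∈ : ∀ b → InBlock s (pred (s (suc (toℕ b)))) b
  last∈ b = inBlock (<⇒≤pred sb<sb′) (pred-below sb<sb′)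
    where
    sb<sb′ = s-<-suc (toℕ b) (FP.toℕ<n b)
    pred-below : ∀ {u v} → u < v → pred v < v
    pred-below {v = suc v} _ = n<1+n v

  ∈⇒< : ∀ {x} {b : Fin k} → InBlock s x b → x < s k
  ∈⇒< {b = b} (inBlock _ x<) = <-≤-trans x< (s-mono (FP.toℕ<n b) ≤-refl)

  block-< : ∀ {u v} {a b : Fin k} → toℕ a < toℕ b → InBlock s u a → InBlock s v b → u < v
  block-< {b = b} a<b (inBlock _ u<) (inBlock b≤v _) =
    <-≤-trans u< (≤-trans (s-mono a<b (<⇒≤ (FP.toℕ<n b))) b≤v)

  block-≤ : ∀ {u v} {a b : Fin k} → InBlock s u a → InBlock s v b → u ≤ v → toℕ a ≤ toℕ b
  block-≤ {a = a} {b} u∈a v∈b u≤v with toℕ a ℕ.≤? toℕ b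
  ... | yes a≤b = a≤b
  ... | no  a≰b = ⊥-elim (<⇒≱ (block-< (≰⇒> a≰b) v∈b u∈a) u≤v)

  block-unique : ∀ {u} {a b : Fin k} → InBlock s u a → InBlock s u b → a ≡ b
  block-unique u∈a u∈b =
    FP.toℕ-injective (≤-antisym (block-≤ u∈a u∈b ≤-refl) (block-≤ u∈b u∈a ≤-refl))

  block-convex : ∀ {u v x} {b : Fin k} → InBlock s u b → InBlock s v b → u ≤ x → x ≤ v → InBlock s x b
  block-convex (inBlock b≤u _) (inBlock _ v<) u≤x x≤v =
    inBlock (≤-trans b≤u u≤x) (≤-<-trans x≤v v<)

  block-cover : ∀ {x} → x < s k → Σ (Fin k) (InBlock s x)
  block-cover {x} = cover-below k ≤-refl
    where
    cover-below : ∀ t → t ≤ k → x < s t → Σ (Fin k) (InBlock s x)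
    cover-below zero    _   x<s0 = ⊥-elim (n≮0 (subst (x <_) s-zero x<s0))
    cover-below (suc t) t<k x<s1+t with x ℕ.<? s t
    ... | yes x<st = cover-below t (<⇒≤ t<k) x<st
    ... | no  x≮st = fromℕ< t<k , inBlock
      (subst (λ u → s u ≤ x) (sym (FP.toℕ-fromℕ< t<k)) (≮⇒≥ x≮st))
      (subst (λ u → x < s (suc u)) (sym (FP.toℕ-fromℕ< t<k)) x<s1+t)

p4321-reverses : ∀ a b → (p4321 a F.< p4321 b → b F.< a) × (b F.< a → p4321 a F.< p4321 b)
p4321-reverses = toWitness {a? = FP.all? λ a → FP.all? λ b →
  (p4321 a F.<? p4321 b →-dec b F.<? a) ×-dec (b F.<? a →-dec p4321 a F.<? p4321 b)} tt

decreasing⇒contains-4321 : ∀ {N} (π : Fin N → Fin N) (e : Fin 4 → Fin N) →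
  (∀ a b → a F.< b → e a F.< e b) → (∀ a b → a F.< b → π (e b) F.< π (e a)) → Contains p4321 π
decreasing⇒contains-4321 π e e-inc πe-dec = e , e-inc , λ a b →
    (λ pa<pb → πe-dec b a (proj₁ (p4321-reverses a b) pa<pb))
  , (λ πa<πb → proj₂ (p4321-reverses a b) (reflect a b πa<πb))
  where
  reflect : ∀ a b → π (e a) F.< π (e b) → b F.< a
  reflect a b πa<πb with FP.<-cmp a b
  ... | tri< a<b _ _  = ⊥-elim (<-asym πa<πb (πe-dec a b a<b))
  ... | tri≈ _ refl _ = ⊥-elim (<-irrefl refl πa<πb)
  ... | tri> _ _ b<a  = b<a

-- π read as a function on ℕ, with the junk value 0 outside [0, N).
extend : ∀ {N} → (Fin N → Fin N) → ℕ → ℕ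
extend {N} π x with x ℕ.<? N
... | yes x<N = toℕ (π (fromℕ< x<N))
... | no  _   = 0

extend-fromℕ< : ∀ {N} (π : Fin N → Fin N) {x} (x<N : x < N) → extend π x ≡ toℕ (π (fromℕ< x<N))
extend-fromℕ< {N} π {x} x<N with x ℕ.<? N
... | yes x<N′ = cong (toℕ ∘ π) (FP.fromℕ<-cong x x refl x<N′ x<N)
... | no  x≮N  = ⊥-elim (x≮N x<N)

decreasing-points⇒contains-4321 : ∀ {N} (π : Fin N → Fin N) {x₀ x₁ x₂ x₃} →
  x₀ < x₁ → x₁ < x₂ → x₂ < x₃ → x₃ < N →
  extend π x₁ < extend π x₀ → extend π x₂ < extend π x₁ → extend π x₃ < extend π x₂ →
  Contains p4321 π
decreasing-points⇒contains-4321 {N} π {x₀} {x₁} {x₂} {x₃}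
  x₀<x₁ x₁<x₂ x₂<x₃ x₃<N πx₁<πx₀ πx₂<πx₁ πx₃<πx₂ =
  decreasing⇒contains-4321 π e
    (λ a b a<b → subst₂ _<_ (sym (toℕ-e a)) (sym (toℕ-e b)) (ascending a<b (≤-pred (FP.toℕ<n b))))
    (λ a b a<b → subst₂ _<_ (extend-fromℕ< π (x<N (toℕ b))) (extend-fromℕ< π (x<N (toℕ a)))
                   (descending a<b (≤-pred (FP.toℕ<n b))))
  where
  x : ℕ → ℕ
  x 0 = x₀
  x 1 = x₁
  x 2 = x₂
  x _ = x₃
  x<N : ∀ t → x t < N
  x<N 0 = <-trans x₀<x₁ (<-trans x₁<x₂ (<-trans x₂<x₃ x₃<N))
  x<N 1 = <-trans x₁<x₂ (<-trans x₂<x₃ x₃<N)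
  x<N 2 = <-trans x₂<x₃ x₃<N
  x<N (suc (suc (suc _))) = x₃<N
  e : Fin 4 → Fin N
  e a = fromℕ< (x<N (toℕ a))
  toℕ-e : ∀ a → toℕ (e a) ≡ x (toℕ a)
  toℕ-e a = FP.toℕ-fromℕ< (x<N (toℕ a))
  ascending : ∀ {i j} → i < j → j ≤ 3 → x i < x j
  ascending = trans-chain {_R_ = _<_} <-trans x λ where
    0 _ → x₀<x₁
    1 _ → x₁<x₂
    2 _ → x₂<x₃
    (suc (suc (suc _))) (s≤s (s≤s (s≤s ())))
  descending : ∀ {i j} → i < j → j ≤ 3 → extend π (x j) < extend π (x i)
  descending = trans-chain {_R_ = λ u v → v < u} (flip <-trans) (extend π ∘ x) λ where
    0 _ → πx₁<πx₀
    1 _ → πx₂<πx₁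
    2 _ → πx₃<πx₂
    (suc (suc (suc _))) (s≤s (s≤s (s≤s ())))

module SimpleInvolution {n} (σ : Fin (3 + n) → Fin (3 + n))
  (σ-invol : IsInvolution σ) (σ-simple : IsSimple σ) where

  σ-injective : ∀ {x y} → σ x ≡ σ y → x ≡ y
  σ-injective {x} {y} σx≡σy = trans (sym (σ-invol x)) (trans (cong σ σx≡σy) (σ-invol y))

  Extreme : Fin (3 + n) → Set
  Extreme v = toℕ v ≡ 0 ⊎ toℕ v ≡ 2 + n

  invariant⇒interval : ∀ {a b} → (∀ x → a F.≤ x → x F.≤ b → a F.≤ σ x × σ x F.≤ b) →
                       IsInterval σ a b
  invariant⇒interval {a} {b} invariant x y z a≤x x≤b a≤y y≤b σx≤σz σz≤σy =
    subst (λ w → a F.≤ w × w F.≤ b) (σ-invol z)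
      (invariant (σ z) (≤-trans (proj₁ (invariant x a≤x x≤b)) σx≤σz)
                       (≤-trans σz≤σy (proj₂ (invariant y a≤y y≤b))))

  extreme-between : ∀ {x y c} → Extreme (σ c) → σ x F.≤ σ c → σ c F.≤ σ y → x ≡ c ⊎ y ≡ c
  extreme-between (inj₁ σc≡0) σx≤σc _ =
    inj₁ (σ-injective (FP.toℕ-injective (trans (n≤0⇒n≡0 (subst (_ ≤_) σc≡0 σx≤σc)) (sym σc≡0))))
  extreme-between {y = y} (inj₂ σc≡last) _ σc≤σy =
    inj₂ (σ-injective (FP.toℕ-injective
      (≤-antisym (subst (_ ≤_) (sym σc≡last) (≤-pred (FP.toℕ<n (σ y)))) σc≤σy)))

  punctured-interval : ∀ c lo hi → (∀ z → z ≢ c → lo F.≤ z × z F.≤ hi) → Extreme (σ c) →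
                       IsInterval σ lo hi
  punctured-interval c lo hi others ext x y z lo≤x x≤hi lo≤y y≤hi σx≤σz σz≤σy with z FP.≟ c
  ... | no z≢c = others z z≢c
  ... | yes refl with extreme-between ext σx≤σz σz≤σy
  ...   | inj₁ refl = lo≤x , x≤hi
  ...   | inj₂ refl = lo≤y , y≤hi

  first second penultimate last : Fin (3 + n)
  first = zero
  second = suc zero
  penultimate = F.inject₁ (F.fromℕ (1 + n))
  last = F.fromℕ (2 + n)

  σ-first-not-extreme : ∀ c → toℕ c ≡ 0 → ¬ Extreme (σ c)
  σ-first-not-extreme c c≡0 ext
    with σ-simple second last (s≤s z≤n) (punctured-interval c _ _ others ext)
    where
    others : ∀ z → z ≢ c → second F.≤ z × z F.≤ last
    others z z≢c = n≢0⇒n>0 (λ z≡0 → z≢c (FP.toℕ-injective (trans z≡0 (sym c≡0))))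
                 , subst (toℕ z ≤_) (sym (FP.toℕ-fromℕ (2 + n))) (≤-pred (FP.toℕ<n z))
  ... | inj₁ ()
  ... | inj₂ (() , _)

  toℕ-penultimate : toℕ penultimate ≡ 1 + n
  toℕ-penultimate = trans (FP.toℕ-inject₁ (F.fromℕ (1 + n))) (FP.toℕ-fromℕ (1 + n))

  σ-last-not-extreme : ∀ c → toℕ c ≡ 2 + n → ¬ Extreme (σ c)
  σ-last-not-extreme c c≡last ext
    with σ-simple first penultimate z≤n (punctured-interval c _ _ others ext)
    where
    others : ∀ z → z ≢ c → first F.≤ z × z F.≤ penultimate
    others z z≢c = z≤n , subst (toℕ z ≤_) (sym toℕ-penultimate)
      (≤-pred (≤∧≢⇒< (≤-pred (FP.toℕ<n z))
                     (λ z≡last → z≢c (FP.toℕ-injective (trans z≡last (sym c≡last))))))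
  ... | inj₁ ()
  ... | inj₂ (_ , penultimate≡last) = 1+n≢n (sym (trans (sym toℕ-penultimate) penultimate≡last))

  fixed-point-straddled : ∀ c → σ c ≡ c → ∃[ l ] l F.< c × c F.< σ l
  fixed-point-straddled c σc≡c with FP.any? (λ l → l F.<? c ×-dec c F.<? σ l)
  ... | yes straddle = straddle
  ... | no ¬straddle with σ-simple first c z≤n (invariant⇒interval prefix-invariant)
    where
    prefix-invariant : ∀ x → first F.≤ x → x F.≤ c → first F.≤ σ x × σ x F.≤ c
    prefix-invariant x _ x≤c with m≤n⇒m<n∨m≡n x≤c
    ... | inj₁ x<c = z≤n , ≮⇒≥ (λ c<σx → ¬straddle (x , x<c , c<σx))
    ... | inj₂ x≡c = z≤n , ≤-reflexive (cong toℕ (trans (cong σ (FP.toℕ-injective x≡c)) σc≡c))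
  ...   | inj₁ refl         = ⊥-elim (σ-first-not-extreme c refl (inj₁ (cong toℕ σc≡c)))
  ...   | inj₂ (_ , c≡last) =
    ⊥-elim (σ-last-not-extreme c c≡last (inj₂ (trans (cong toℕ σc≡c) c≡last)))

-- The position blocks (p) and value blocks (w) of an inflation of σ, abstracted.  The hypotheses
-- are symmetric under exchanging p and w (and m with m ∘ σ), which BlockSizes exploits.
module BlockCorrespondence {n} (σ : Fin (3 + n) → Fin (3 + n))
  (σ-invol : IsInvolution σ) (σ-simple : IsSimple σ) (m : Fin (3 + n) → ℕ) (m-pos : ∀ b → 1 ≤ m b)
  (p w : ℕ → ℕ) (p-zero : p 0 ≡ 0) (w-zero : w 0 ≡ 0)
  (p-step : ∀ b → p (suc (toℕ b)) ≡ p (toℕ b) + m b)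
  (w-step : ∀ b → w (suc (toℕ b)) ≡ w (toℕ b) + m (σ b))
  (N : ℕ) (p-total : p (3 + n) ≡ N) (w-total : w (3 + n) ≡ N)
  (π : ℕ → ℕ) (π-invol : ∀ x → x < N → π (π x) ≡ x)
  (π-maps : ∀ {x b} → InBlock p x b → InBlock w (π x) (σ b)) where

  open SimpleInvolution σ σ-invol σ-simple
  module P = Partition {3 + n} p m p-zero p-step m-pos
  module W = Partition {3 + n} w (m ∘ σ) w-zero w-step (m-pos ∘ σ)

  π-below-N : ∀ {x} → x < N → π x < N
  π-below-N {x} x<N with P.block-cover (subst (x <_) (sym p-total) x<N)
  ... | _ , x∈b = subst (π x <_) w-total (W.∈⇒< (π-maps x∈b))

  π-maps⁻ : ∀ {x b} → InBlock w x b → InBlock p (π x) (σ b)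
  π-maps⁻ {x} {b} x∈b = from-block (P.block-cover (subst (π x <_) (sym p-total) (π-below-N x<N)))
    where
    x<N : x < N
    x<N = subst (x <_) w-total (W.∈⇒< x∈b)
    from-block : Σ (Fin (3 + n)) (InBlock p (π x)) → InBlock p (π x) (σ b)
    from-block (c , πx∈c) = subst (InBlock p (π x)) (trans (sym (σ-invol c)) (cong σ σc≡b)) πx∈c
      where
      σc≡b : σ c ≡ b
      σc≡b = W.block-unique (subst (λ y → InBlock w y (σ c)) (π-invol x x<N) (π-maps πx∈c)) x∈b

  -- The w-block σ z starts at a point r lying
  -- between the π-images of points of w-block e in p-blocks x and y; those images lie in the
  -- segment p-block σ e, hence so does r, and so π r, a point of p-block z, lies in w-block e.
  w-block-spans-interval : ∀ e {a c} → InBlock p (w (toℕ e)) a → InBlock p (pred (w (suc (toℕ e)))) c →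
                           IsInterval σ a c
  w-block-spans-interval e {a} {c} first∈a last∈c x y z a≤x x≤c a≤y y≤c σx≤σz σz≤σy
    with toℕ (σ x) ℕ.≟ toℕ (σ z) | toℕ (σ z) ℕ.≟ toℕ (σ y)
  ... | yes σx≡σz | _ = subst between (σ-injective (FP.toℕ-injective σx≡σz)) (a≤x , x≤c)
    where between = λ v → toℕ a ≤ toℕ v × toℕ v ≤ toℕ c
  ... | no _ | yes σz≡σy = subst between (sym (σ-injective (FP.toℕ-injective σz≡σy))) (a≤y , y≤c)
    where between = λ v → toℕ a ≤ toℕ v × toℕ v ≤ toℕ c
  ... | no σx≢σz | no σz≢σy =
    P.block-≤ first∈a πr∈z (from-start πr∈e) , P.block-≤ πr∈z last∈c (<⇒≤pred (before-end πr∈e))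
    where
    meeting-point : ∀ v → toℕ a ≤ toℕ v → toℕ v ≤ toℕ c → ∃[ q ] InBlock p q v × InBlock w q e
    meeting-point v a≤v v≤c = p (toℕ v) ⊔ w (toℕ e)
      , inBlock (m≤m⊔n _ _) (⊔-lub (P.s-<-suc _ (FP.toℕ<n v))
                                   (<-≤-trans (before-end first∈a) (P.s-mono (s≤s a≤v) (FP.toℕ<n v))))
      , inBlock (m≤n⊔m _ _) (⊔-lub (≤-<-trans (≤-trans (P.s-mono v≤c (<⇒≤ (FP.toℕ<n c))) (from-start last∈c))
                                              (before-end (W.last∈ e)))
                                   (W.s-<-suc _ (FP.toℕ<n e)))
    qx = meeting-point x a≤x x≤c
    qy = meeting-point y a≤y y≤c
    r = w (toℕ (σ z))
    πqx<r : π (proj₁ qx) < r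
    πqx<r = W.block-< (≤∧≢⇒< σx≤σz σx≢σz) (π-maps (proj₁ (proj₂ qx))) (W.start∈ (σ z))
    r<πqy : r < π (proj₁ qy)
    r<πqy = W.block-< (≤∧≢⇒< σz≤σy σz≢σy) (W.start∈ (σ z)) (π-maps (proj₁ (proj₂ qy)))
    r∈σe : InBlock p r (σ e)
    r∈σe = P.block-convex (π-maps⁻ (proj₂ (proj₂ qx))) (π-maps⁻ (proj₂ (proj₂ qy)))
                          (<⇒≤ πqx<r) (<⇒≤ r<πqy)
    πr∈e : InBlock w (π r) e
    πr∈e = subst (InBlock w (π r)) (σ-invol e) (π-maps r∈σe)
    πr∈z : InBlock p (π r) z
    πr∈z = subst (InBlock p (π r)) (σ-invol z) (π-maps⁻ (W.start∈ (σ z)))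

  -- If it did, w-block e, of size m (σ e), would outgrow all p-blocks but the last, so σ e would be
  -- the last block.
  first-w-block-ends-before-last-p-block : ∀ (e c : Fin (3 + n)) → toℕ e ≡ 0 → toℕ c ≡ 2 + n →
                                           ¬ InBlock p (pred (w (suc (toℕ e)))) c
  first-w-block-ends-before-last-p-block e c e≡0 c≡last (inBlock c≤L _) with toℕ (σ e) ℕ.≟ 2 + n
  ... | yes σe≡last = σ-first-not-extreme e e≡0 (inj₂ σe≡last)
  ... | no  σe≢last = <-irrefl refl (begin-strict
    m (σ e)                  ≤⟨ P.size≤s (σ e) (≤∧≢⇒< (≤-pred (FP.toℕ<n (σ e))) σe≢last) (n≤1+n (2 + n)) ⟩
    p (2 + n)                ≡⟨ cong p (sym c≡last) ⟩
    p (toℕ c)                ≤⟨ c≤L ⟩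
    pred (w (suc (toℕ e)))   <⟨ before-end (W.last∈ e) ⟩
    w (suc (toℕ e))          ≡⟨ w-step e ⟩
    w (toℕ e) + m (σ e)      ≡⟨ cong (λ t → w t + m (σ e)) e≡0 ⟩
    w 0 + m (σ e)            ≡⟨ cong (_+ m (σ e)) w-zero ⟩
    m (σ e)                  ∎)
    where open ≤-Reasoning

  no-overtaking : ∀ e → p (toℕ e) ≡ w (toℕ e) → ¬ p (suc (toℕ e)) < w (suc (toℕ e))
  no-overtaking e pe≡we p<w
    with P.block-cover (subst (pred (w (suc (toℕ e))) <_) (trans w-total (sym p-total)) (W.∈⇒< (W.last∈ e)))
  ... | c , last∈c
    with σ-simple e c (P.block-≤ first∈e last∈c (from-start (W.last∈ e)))
                      (w-block-spans-interval e first∈e last∈c)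
    where
    first∈e : InBlock p (w (toℕ e)) e
    first∈e = subst (λ u → InBlock p u e) pe≡we (P.start∈ e)
  ...   | inj₁ refl           = <-irrefl refl (<-≤-trans (before-end last∈c) (<⇒≤pred p<w))
  ...   | inj₂ (e≡0 , c≡last) = first-w-block-ends-before-last-p-block e c e≡0 c≡last last∈c

module BlockSizes {n} (σ : Fin (3 + n) → Fin (3 + n))
  (σ-invol : IsInvolution σ) (σ-simple : IsSimple σ) (m : Fin (3 + n) → ℕ) (m-pos : ∀ b → 1 ≤ m b)
  (p w : ℕ → ℕ) (p-zero : p 0 ≡ 0) (w-zero : w 0 ≡ 0)
  (p-step : ∀ b → p (suc (toℕ b)) ≡ p (toℕ b) + m b)
  (w-step : ∀ b → w (suc (toℕ b)) ≡ w (toℕ b) + m (σ b))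
  (N : ℕ) (p-total : p (3 + n) ≡ N) (w-total : w (3 + n) ≡ N)
  (π : ℕ → ℕ) (π-invol : ∀ x → x < N → π (π x) ≡ x)
  (π-maps : ∀ {x b} → InBlock p x b → InBlock w (π x) (σ b)) where

  module Forward = BlockCorrespondence σ σ-invol σ-simple m m-pos p w p-zero w-zero p-step w-step
                     N p-total w-total π π-invol π-maps

  p-step-σσ : ∀ b → p (suc (toℕ b)) ≡ p (toℕ b) + m (σ (σ b))
  p-step-σσ b = subst (λ c → p (suc (toℕ b)) ≡ p (toℕ b) + m c) (sym (σ-invol b)) (p-step b)

  module Backward = BlockCorrespondence σ σ-invol σ-simple (m ∘ σ) (m-pos ∘ σ) w p w-zero p-zero w-step p-step-σσ
                      N w-total p-total π π-invol Forward.π-maps⁻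

  starts-agree-suc : ∀ b → p (toℕ b) ≡ w (toℕ b) → p (suc (toℕ b)) ≡ w (suc (toℕ b))
  starts-agree-suc b pb≡wb with <-cmp (p (suc (toℕ b))) (w (suc (toℕ b)))
  ... | tri< p<w _ _ = ⊥-elim (Forward.no-overtaking b pb≡wb p<w)
  ... | tri≈ _ p≡w _ = p≡w
  ... | tri> _ _ w<p = ⊥-elim (Backward.no-overtaking b (sym pb≡wb) w<p)

  starts-agree : ∀ t → t ≤ 3 + n → p t ≡ w t
  starts-agree zero    _   = trans p-zero (sym w-zero)
  starts-agree (suc t) t<k = subst (λ u → p (suc u) ≡ w (suc u)) (FP.toℕ-fromℕ< t<k)
    (starts-agree-suc (fromℕ< t<k)
      (subst (λ u → p u ≡ w u) (sym (FP.toℕ-fromℕ< t<k)) (starts-agree t (<⇒≤ t<k))))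

  sizes-agree : ∀ b → m (σ b) ≡ m b
  sizes-agree b = +-cancelˡ-≡ (p (toℕ b)) (m (σ b)) (m b) (begin
    p (toℕ b) + m (σ b)   ≡⟨ cong (_+ m (σ b)) (starts-agree (toℕ b) (<⇒≤ (FP.toℕ<n b))) ⟩
    w (toℕ b) + m (σ b)   ≡⟨ w-step b ⟨
    w (suc (toℕ b))       ≡⟨ starts-agree (suc (toℕ b)) (FP.toℕ<n b) ⟨
    p (suc (toℕ b))       ≡⟨ p-step b ⟩
    p (toℕ b) + m b       ∎)
    where open ≡-Reasoning

strictlyIncreasing⇒inflationary : ∀ {k} (f : Fin k → Fin k) → (∀ {i j} → i F.< j → f i F.< f j) →
                                  ∀ i → i F.≤ f i
strictlyIncreasing⇒inflationary {k} f f-inc i = at-rank (toℕ i) i refl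
  where
  at-rank : ∀ t i → toℕ i ≡ t → toℕ i ≤ toℕ (f i)
  at-rank zero    i i≡0   = subst (_≤ toℕ (f i)) (sym i≡0) z≤n
  at-rank (suc t) i i≡1+t = subst (_≤ toℕ (f i)) (sym i≡1+t)
                              (≤-<-trans (subst (_≤ toℕ (f i′)) i′≡t (at-rank t i′ i′≡t)) (f-inc i′<i))
    where
    t<k : t < k
    t<k = <-trans (subst (t <_) (sym i≡1+t) (n<1+n t)) (FP.toℕ<n i)
    i′ : Fin k
    i′ = fromℕ< t<k
    i′≡t : toℕ i′ ≡ t
    i′≡t = FP.toℕ-fromℕ< t<k
    i′<i : i′ F.< i
    i′<i = subst₂ _<_ (sym i′≡t) (sym i≡1+t) (n<1+n t)

strictlyIncreasing-bijection⇒id : ∀ {k} (f : Fin k → Fin k) → IsPerm f →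
                                  (∀ {i j} → i F.< j → f i F.< f j) → ∀ i → f i ≡ i
strictlyIncreasing-bijection⇒id {k} f (f-inj , f-surj) f-inc i =
  FP.toℕ-injective (≤-antisym fi≤i (strictlyIncreasing⇒inflationary f f-inc i))
  where
  g : Fin k → Fin k
  g y = proj₁ (f-surj y)
  f∘g : ∀ y → f (g y) ≡ y
  f∘g y = proj₂ (f-surj y) refl
  g-inc : ∀ {i j} → i F.< j → g i F.< g j
  g-inc {i} {j} i<j with FP.<-cmp (g i) (g j)
  ... | tri< gi<gj _ _ = gi<gj
  ... | tri≈ _ gi≡gj _ = ⊥-elim (<-irrefl (cong toℕ (trans (sym (f∘g i)) (trans (cong f gi≡gj) (f∘g j)))) i<j)
  ... | tri> _ _ gj<gi = ⊥-elim (<-asym i<j (subst₂ (λ u v → u F.< v) (f∘g j) (f∘g i) (f-inc gj<gi)))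
  fi≤i : toℕ (f i) ≤ toℕ i
  fi≤i = subst (λ j → toℕ (f i) ≤ toℕ j) (f-inj (f∘g (f i))) (strictlyIncreasing⇒inflationary g g-inc (f i))

extend-toℕ : ∀ {N} (π : Fin N → Fin N) i → extend π (toℕ i) ≡ toℕ (π i)
extend-toℕ π i = trans (extend-fromℕ< π (FP.toℕ<n i)) (cong (toℕ ∘ π) (FP.fromℕ<-toℕ i (FP.toℕ<n i)))

module Inflation {n} (σ : Fin (3 + n) → Fin (3 + n)) (σ-invol : IsInvolution σ) (σ-simple : IsSimple σ)
  (m : Fin (3 + n) → ℕ) (m-pos : ∀ i → 1 ≤ m i)
  (α : (i : Fin (3 + n)) → Fin (m i) → Fin (m i)) (α-perm : ∀ i → IsPerm (α i))
  (π : Fin (Σfin m) → Fin (Σfin m)) (π-inflation : IsInflation σ m α π)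
  (π-invol : IsInvolution π) (π-avoids : Avoids p4321 π) where

  open SimpleInvolution σ σ-invol σ-simple using (σ-injective; fixed-point-straddled)

  N : ℕ
  N = Σfin m

  π̂ : ℕ → ℕ
  π̂ = extend π

  π̂-invol : ∀ x → x < N → π̂ (π̂ x) ≡ x
  π̂-invol x x<N = begin
    π̂ (π̂ x)             ≡⟨ cong π̂ (extend-fromℕ< π x<N) ⟩
    π̂ (toℕ (π y))       ≡⟨ extend-toℕ π (π y) ⟩
    toℕ (π (π y))       ≡⟨ cong toℕ (π-invol y) ⟩
    toℕ y               ≡⟨ FP.toℕ-fromℕ< x<N ⟩
    x                   ∎
    where
    open ≡-Reasoning
    y = fromℕ< x<N

  P W : ℕ → ℕ
  P = rankStart id m
  W = rankStart σ m

  P-step : ∀ b → P (suc (toℕ b)) ≡ P (toℕ b) + m b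
  P-step = rankStart-suc id m id

  W-step : ∀ b → W (suc (toℕ b)) ≡ W (toℕ b) + m (σ b)
  W-step b = subst (λ c → W (suc (toℕ c)) ≡ W (toℕ c) + m (σ b)) (σ-invol b)
                   (rankStart-suc σ m σ-injective (σ b))

  module Pt = Partition {3 + n} P m (rankStart-zero id m) P-step m-pos

  π̂-offset : ∀ b (j : Fin (m b)) → π̂ (P (toℕ b) + toℕ j) ≡ W (toℕ (σ b)) + toℕ (α b j)
  π̂-offset b j = trans (extend-fromℕ< π x<N) (π-inflation b j (fromℕ< x<N) (FP.toℕ-fromℕ< x<N))
    where
    x<N : P (toℕ b) + toℕ j < N
    x<N = subst (P (toℕ b) + toℕ j <_) (rankStart-total id m) (Pt.∈⇒< (Pt.offset∈ b j))

  π̂-maps : ∀ {x b} → InBlock P x b → InBlock W (π̂ x) (σ b)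
  π̂-maps {x} {b} x∈b = from-offset (Pt.block-offset x∈b)
    where
    from-offset : ∃[ j ] x ≡ P (toℕ b) + toℕ {m b} j → InBlock W (π̂ x) (σ b)
    from-offset (j , refl) = subst (λ y → InBlock W y (σ b)) (sym (π̂-offset b j))
      (inBlock (m≤m+n _ _) (subst (W (toℕ (σ b)) + toℕ (α b j) <_)
                                  (sym (trans (W-step (σ b)) (cong (λ c → W (toℕ (σ b)) + m c) (σ-invol b))))
                                  (+-monoʳ-< (W (toℕ (σ b))) (FP.toℕ<n (α b j)))))

  open BlockSizes σ σ-invol σ-simple m m-pos P W (rankStart-zero id m) (rankStart-zero σ m) P-step W-step
                  N (rankStart-total id m) (rankStart-total σ m) π̂ π̂-invol π̂-maps
    public using (starts-agree; sizes-agree)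

  P≡W-at : ∀ b → P (toℕ b) ≡ W (toℕ b) × P (suc (toℕ b)) ≡ W (suc (toℕ b))
  P≡W-at b = starts-agree (toℕ b) (<⇒≤ (FP.toℕ<n b)) , starts-agree (suc (toℕ b)) (FP.toℕ<n b)

  π̂-maps-blocks : ∀ {x b} → InBlock P x b → InBlock P (π̂ x) (σ b)
  π̂-maps-blocks {x} {b} x∈b =
    inBlock (subst (_≤ π̂ x) (sym (proj₁ (P≡W-at (σ b)))) (from-start (π̂-maps x∈b)))
            (subst (π̂ x <_) (sym (proj₂ (P≡W-at (σ b)))) (before-end (π̂-maps x∈b)))

  π̂-offset-P : ∀ b (j : Fin (m b)) → π̂ (P (toℕ b) + toℕ j) ≡ P (toℕ (σ b)) + toℕ (α b j)
  π̂-offset-P b j = trans (π̂-offset b j) (cong (_+ toℕ (α b j)) (sym (proj₁ (P≡W-at (σ b)))))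

  no-decreasing-4 : ∀ {x₀ x₁ x₂ x₃} → x₀ < x₁ → x₁ < x₂ → x₂ < x₃ → x₃ < N →
                    ¬ (π̂ x₁ < π̂ x₀ × π̂ x₂ < π̂ x₁ × π̂ x₃ < π̂ x₂)
  no-decreasing-4 x₀<x₁ x₁<x₂ x₂<x₃ x₃<N (π₁<π₀ , π₂<π₁ , π₃<π₂) =
    π-avoids (decreasing-points⇒contains-4321 π x₀<x₁ x₁<x₂ x₂<x₃ x₃<N π₁<π₀ π₂<π₁ π₃<π₂)

  ∈⇒<N : ∀ {x} {b : Fin (3 + n)} → InBlock P x b → x < N
  ∈⇒<N {x} x∈b = subst (x <_) (rankStart-total id m) (Pt.∈⇒< x∈b)

  -- An inversion q₁ < q₂ inside block b extends to a 4321: by π̂ q₂, π̂ q₁ if σ b ≠ b, and by the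
  -- starts of two blocks straddling b if σ b = b.
  block-inversion-free : ∀ {b : Fin (3 + n)} {q₁ q₂} → InBlock P q₁ b → InBlock P q₂ b → q₁ < q₂ →
                         ¬ π̂ q₂ < π̂ q₁
  block-inversion-free {b} {q₁} {q₂} q₁∈b q₂∈b q₁<q₂ πq₂<πq₁ with <-cmp (toℕ b) (toℕ (σ b))
  ... | tri< b<σb _ _ = no-decreasing-4 q₁<q₂ q₂<πq₂ πq₂<πq₁ (∈⇒<N (π̂-maps-blocks q₁∈b))
    ( πq₂<πq₁
    , subst₂ _<_ (sym (π̂-invol q₂ (∈⇒<N q₂∈b))) refl q₂<πq₂
    , subst₂ _<_ (sym (π̂-invol q₁ (∈⇒<N q₁∈b))) (sym (π̂-invol q₂ (∈⇒<N q₂∈b))) q₁<q₂ )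
    where
    q₂<πq₂ : q₂ < π̂ q₂
    q₂<πq₂ = Pt.block-< b<σb q₂∈b (π̂-maps-blocks q₂∈b)
  ... | tri> _ _ σb<b = no-decreasing-4 πq₂<πq₁ πq₁<q₁ q₁<q₂ (∈⇒<N q₂∈b)
    ( subst₂ _<_ (sym (π̂-invol q₁ (∈⇒<N q₁∈b))) (sym (π̂-invol q₂ (∈⇒<N q₂∈b))) q₁<q₂
    , subst₂ _<_ refl (sym (π̂-invol q₁ (∈⇒<N q₁∈b))) πq₁<q₁
    , πq₂<πq₁ )
    where
    πq₁<q₁ : π̂ q₁ < q₁
    πq₁<q₁ = Pt.block-< σb<b (π̂-maps-blocks q₁∈b) q₁∈b
  ... | tri≈ _ b≡σb _ with fixed-point-straddled b (sym (FP.toℕ-injective b≡σb))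
  ...   | l , l<b , b<σl = no-decreasing-4
    (Pt.block-< l<b (Pt.start∈ l) q₁∈b) q₁<q₂ (Pt.block-< b<σl q₂∈b (Pt.start∈ (σ l)))
    (∈⇒<N (Pt.start∈ (σ l)))
    ( Pt.block-< b<σl (image-in-b q₁∈b) (π̂-maps-blocks (Pt.start∈ l))
    , πq₂<πq₁
    , Pt.block-< l<b (subst (InBlock P _) (σ-invol l) (π̂-maps-blocks (Pt.start∈ (σ l)))) (image-in-b q₂∈b) )
    where
    image-in-b : ∀ {x} → InBlock P x b → InBlock P (π̂ x) b
    image-in-b x∈b = subst (InBlock P _) (sym (FP.toℕ-injective b≡σb)) (π̂-maps-blocks x∈b)

  π̂-increasing-in-block : ∀ {b : Fin (3 + n)} {q₁ q₂} → InBlock P q₁ b → InBlock P q₂ b → q₁ < q₂ →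
                          π̂ q₁ < π̂ q₂
  π̂-increasing-in-block q₁∈b q₂∈b q₁<q₂ with <-cmp (π̂ _) (π̂ _)
  ... | tri< πq₁<πq₂ _ _ = πq₁<πq₂
  ... | tri≈ _ πq₁≡πq₂ _ = ⊥-elim (<-irrefl q₁≡q₂ q₁<q₂)
    where
    q₁≡q₂ = trans (sym (π̂-invol _ (∈⇒<N q₁∈b))) (trans (cong π̂ πq₁≡πq₂) (π̂-invol _ (∈⇒<N q₂∈b)))
  ... | tri> _ _ πq₂<πq₁ = ⊥-elim (block-inversion-free q₁∈b q₂∈b q₁<q₂ πq₂<πq₁)

  α-increasing : ∀ b {j₁ j₂ : Fin (m b)} → j₁ F.< j₂ → α b j₁ F.< α b j₂
  α-increasing b {j₁} {j₂} j₁<j₂ = +-cancelˡ-< (P (toℕ (σ b))) _ _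
    (subst₂ _<_ (π̂-offset-P b j₁) (π̂-offset-P b j₂)
      (π̂-increasing-in-block (Pt.offset∈ b j₁) (Pt.offset∈ b j₂) (+-monoʳ-< (P (toℕ b)) j₁<j₂)))

  α-id : ∀ b j → α b j ≡ j
  α-id b = strictlyIncreasing-bijection⇒id (α b) (α-perm b) (α-increasing b)

theorem3p2 : (k : ℕ) → 3 ≤ k → (σ : Fin k → Fin k) → IsPerm σ → IsSimple σ →
    IsInvolution σ → Avoids p4321 σ →
    (m : Fin k → ℕ) → (∀ i → 1 ≤ m i) →
    (α : (i : Fin k) → Fin (m i) → Fin (m i)) → (∀ i → IsPerm (α i)) →
    (π : Fin (Σfin m) → Fin (Σfin m)) → IsInflation σ m α π →
    IsInvolution π → Avoids p4321 π →
    (∀ i → σ i ≡ i → ∀ j → α i j ≡ j) ×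
    (∀ i → ¬ σ i ≡ i →
      m i ≡ m (σ i) × (∀ j → α i j ≡ j) × (∀ j → α (σ i) j ≡ j))
theorem3p2 _ (s≤s (s≤s (s≤s z≤n))) σ _ σ-simple σ-invol _ m m-pos α α-perm π π-inflation π-invol π-avoids =
  (λ i _ → α-id i) , (λ i _ → sym (sizes-agree i) , α-id i , α-id (σ i))
  where open Inflation σ σ-invol σ-simple m m-pos α α-perm π π-inflation π-invol π-avoids
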